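{- Let $k>1$ be an integer, $\sigma$ a permutation of $\{0,1,\ldots,n\}$, and let $r=[a_0;a_1,\ldots,a_n]$ be a $(\sigma,k)$-permutiple with $r'=[a_{\sigma(0)};a_{\sigma(1)},\ldots,a_{\sigma(n)}]$, tails $(\gamma_j)$ of $r$ and $(\gamma'_j)$ of $r'$. The following are equivalent: (1) $r$ is perfect; (2) $k=\frac{\gamma_0}{\gamma'_0}=\frac{\gamma'_1}{\gamma_1}=\frac{\gamma_2}{\gamma'_2}=\frac{\gamma'_3}{\gamma_3}=\cdots$, i.e. $\gamma_j=k\gamma'_j$ for even $j$ and $\gamma'_j=k\gamma_j$ for odd $j$ ($0\le j\le n-1$); (3) $\frac1k G(x)=G(kx)$ for $x=\gamma'_0,\gamma_1,\gamma'_2,\gamma_3,\ldots$ (i.e. $x=\gamma'_j$ for even $j$ and $x=\gamma_j$ for odd $j$), and $G(\frac1k x)=kG(x)$ for $x=\gamma_0,\gamma'_1,\gamma_2,\gamma'_3,\ldots$ (i.e. $x=\gamma_j$ for even $j$ and $x=\gamma'_j$ for odd $j$), where $0\le j\le n-1$.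
   Context: For positive integers $a_0,\ldots,a_n$, $[a_0;a_1,\ldots,a_n]$ denotes the finite simple continued fraction $a_0+1/(a_1+1/(\cdots+1/a_n))$; all finite continued fractions are assumed in canonical form (last digit at least $2$ when there are at least two digits). For an integer $k>1$ and a permutation $\sigma$ of $\{0,\ldots,n\}$, $r=[a_0;\ldots,a_n]$ is a $(\sigma,k)$-permutiple if $r=k\,[a_{\sigma(0)};a_{\sigma(1)},\ldots,a_{\sigma(n)}]$. It is perfect if $a_j=k\,a_{\sigma(j)}$ for every even $j$ and $a_{\sigma(j)}=k\,a_j$ for every odd $j$ ($0\le j\le n$). Define $G:[0,\infty)\to[0,1)$ by $G(0)=0$ and $G(x)=\frac1x-\lfloor\frac1x\rfloor$ for $x>0$. The tails of $r$ are $\gamma_0=r-\lfloor r\rfloor$, $\gamma_{j+1}=G(\gamma_j)$; the tails $\gamma'_j$ of $r'$ are defined in the same way from $r'$. The index ranges in (2) and (3), written with "$\cdots$" in the paper, are taken as $0\le j\le n-1$. -}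

module Defs where

open import Data.Nat as ℕ using (ℕ; zero; suc; _<_; _≤_)
open import Data.Nat.DivMod using (_%_)
open import Data.Integer as ℤ using (ℤ; +_)
open import Data.Fin using (Fin; toℕ; fromℕ)
import Data.Fin as Fin
open import Data.Fin.Permutation using (Permutation′; _⟨$⟩ʳ_)
open import Data.Rational as ℚ using (ℚ; 0ℚ; 1/_; _+_; _-_; _*_; floor; _/_; ≢-nonZero)
open import Data.Rational.Properties using (_≟_)
open import Relation.Binary.PropositionalEquality using (_≡_)
open import Relation.Nullary using (yes; no; ¬_)

ℕ→ℚ : ℕ → ℚ
ℕ→ℚ m = (+ m) / 1

ℤ→ℚ : ℤ → ℚ
ℤ→ℚ z = z / 1

-- reciprocal, extended by 1/0 := 0 (only used on positive arguments,
-- and on 0 where it yields G(0) = 0 as required)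
recip : ℚ → ℚ
recip p with p ≟ 0ℚ
... | yes _ = 0ℚ
... | no p≢0 = 1/_ p {{≢-nonZero p≢0}}

frac : ℚ → ℚ
frac x = x - ℤ→ℚ (floor x)

G : ℚ → ℚ
G x with x ≟ 0ℚ
... | yes _ = 0ℚ
... | no _ = frac (recip x)

cf : (n : ℕ) → (Fin (suc n) → ℕ) → ℚ
cf zero a = ℕ→ℚ (a Fin.zero)
cf (suc n) a = ℕ→ℚ (a Fin.zero) + recip (cf n (λ i → a (Fin.suc i)))

CanonicalDigits : (n : ℕ) → (Fin (suc n) → ℕ) → Set
CanonicalDigits n a = (∀ i → 1 ≤ a i) × (1 ≤ n → 2 ≤ a (fromℕ n))
  where open import Data.Product using (_×_)

tails : ℚ → ℕ → ℚ
tails r zero = frac r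
tails r (suc j) = G (tails r j)

Even : ℕ → Set
Even j = j % 2 ≡ 0

permuted : ∀ {n} → Permutation′ (suc n) → (Fin (suc n) → ℕ) → Fin (suc n) → ℕ
permuted σ a j = a (σ ⟨$⟩ʳ j)

IsPermutiple : (n k : ℕ) → Permutation′ (suc n) → (Fin (suc n) → ℕ) → Set
IsPermutiple n k σ a = cf n a ≡ ℕ→ℚ k * cf n (permuted σ a)

Perfect : (n k : ℕ) → Permutation′ (suc n) → (Fin (suc n) → ℕ) → Set
Perfect n k σ a = ∀ (j : Fin (suc n)) →
  (Even (toℕ j) → a j ≡ k ℕ.* a (σ ⟨$⟩ʳ j)) ×
  (¬ Even (toℕ j) → a (σ ⟨$⟩ʳ j) ≡ k ℕ.* a j)
  where open import Data.Product using (_×_)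

Cond2 : (n k : ℕ) → (γ γ' : ℕ → ℚ) → Set
Cond2 n k γ γ' = ∀ j → suc j ≤ n →
  (Even j → γ j ≡ ℕ→ℚ k * γ' j) ×
  (¬ Even j → γ' j ≡ ℕ→ℚ k * γ j)
  where open import Data.Product using (_×_)

Cond3 : (n k : ℕ) → (γ γ' : ℕ → ℚ) → Set
Cond3 n k γ γ' = ∀ j → suc j ≤ n →
  (Even j → (recip (ℕ→ℚ k) * G (γ' j) ≡ G (ℕ→ℚ k * γ' j)) ×
            (G (recip (ℕ→ℚ k) * γ j) ≡ ℕ→ℚ k * G (γ j))) ×
  (¬ Even j → (recip (ℕ→ℚ k) * G (γ j) ≡ G (ℕ→ℚ k * γ j)) ×
              (G (recip (ℕ→ℚ k) * γ' j) ≡ ℕ→ℚ k * G (γ' j)))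
  where open import Data.Product using (_×_)

module Submission where

-- Write b = a ∘ σ, r = a₀ + 1/x, r' = b₀ + 1/x' with x = [a₁; …, aₙ], x' = [b₁; …, bₙ];
-- then γ₀ = 1/x, γ'₀ = 1/x' and the later tails of r, r' are those of x, x'.  At
-- position j the ratio k is "oriented": u = k·v for even j, v = k·u for odd j, and
-- reciprocals swap the orientation.  Everything is proved for an arbitrary k > 0 by
-- induction on n, peeling off the first digit:
--   (1) ⇒ (2): perfect digits put r, r' (hence γ₀, γ'₀, hence x, x') in ratio k.
--   (2) or (3) ⇒ (1): from r = k r' recover γ₀ = k γ'₀, cancel to get a₀ = k b₀, and
--     recurse on x, x' with flipped orientation.  Under (3) the recovery compares
--     y = k γ'₀ with 1: y < 1 compares fractional parts, y = 1 forces γ₀ = 0, and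
--     y > 1 turns the Gauss identity into frac x' = x', impossible since x' > 1.
--   (1) ⇒ (3): the Gauss identities at j follow from the ratios at j and j + 1.
-- After general facts on ℕ → ℚ, floor, reciprocals, the Gauss map and tails of
-- canonical continued fractions, the module Ratio carries out these inductions.

open import Defs
open import Data.Nat using (ℕ; suc; _<_)
open import Data.Fin using (Fin)
open import Data.Fin.Permutation using (Permutation′)
open import Data.Product using (_×_)
open import Function.Bundles using (_⇔_)

open import Data.Nat as ℕ using (zero; z≤n; s≤s; z<s)
import Data.Nat.Properties as ℕP
import Data.Nat.DivMod as ℕD
open import Data.Nat.Coprimality as Coprimality using (Coprime)
open import Data.Integer as ℤ using (ℤ; +_; -[1+_])
import Data.Integer.Properties as ℤP
open import Data.Rational as ℚ using (ℚ; mkℚ; 0ℚ; 1ℚ; _+_; _*_; _-_; floor; ↥_)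
import Data.Rational.Properties as ℚP
open import Data.Rational.Solver using (module +-*-Solver)
open import Data.Bool using (Bool; true; false; not)
open import Data.Bool.Properties using (not-involutive)
open import Data.Fin as Fin using (toℕ; fromℕ)
open import Data.Product using (_,_; proj₁; proj₂)
open import Data.Sum using (_⊎_; inj₁; inj₂)
open import Data.Empty using (⊥-elim)
open import Function.Bundles using (mk⇔; Equivalence)
import Function.Properties.Equivalence as ⇔
open import Relation.Nullary using (yes; no; ¬_)
open import Relation.Binary.Definitions using (tri<; tri≈; tri>)
open import Relation.Binary.PropositionalEquality
open +-*-Solver using (solve; _:+_; _:-_; _:*_; _:=_)

coprime-1 : ∀ m → Coprime m 1
coprime-1 m = Coprimality.sym (Coprimality.1-coprimeTo m)

ℕ→ℚ≡mkℚ : ∀ m → ℕ→ℚ m ≡ mkℚ (+ m) 0 (coprime-1 m)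
ℕ→ℚ≡mkℚ m = ℚP.normalize-coprime (coprime-1 m)

ℕ→ℚ-injective : ∀ {m n} → ℕ→ℚ m ≡ ℕ→ℚ n → m ≡ n
ℕ→ℚ-injective {m} {n} eq =
  ℤP.+-injective (cong ↥_ (trans (sym (ℕ→ℚ≡mkℚ m)) (trans eq (ℕ→ℚ≡mkℚ n))))

ℕ→ℚ-+ : ∀ m n → ℕ→ℚ (m ℕ.+ n) ≡ ℕ→ℚ m + ℕ→ℚ n
ℕ→ℚ-+ m n = sym (trans (cong₂ _+_ (ℕ→ℚ≡mkℚ m) (ℕ→ℚ≡mkℚ n))
  (ℚP./-cong {+ m ℤ.* + 1 ℤ.+ + n ℤ.* + 1} {1} {+ (m ℕ.+ n)} {1}
     (cong₂ ℤ._+_ (ℤP.*-identityʳ (+ m)) (ℤP.*-identityʳ (+ n))) refl))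

ℕ→ℚ-* : ∀ m n → ℕ→ℚ (m ℕ.* n) ≡ ℕ→ℚ m * ℕ→ℚ n
ℕ→ℚ-* m n = sym (trans (cong₂ _*_ (ℕ→ℚ≡mkℚ m) (ℕ→ℚ≡mkℚ n))
  (ℚP./-cong {+ m ℤ.* + n} {1} {+ (m ℕ.* n)} {1} (sym (ℤP.pos-* m n)) refl))

ℕ→ℚ-mono-≤ : ∀ {m n} → m ℕ.≤ n → ℕ→ℚ m ℚ.≤ ℕ→ℚ n
ℕ→ℚ-mono-≤ {m} {n} m≤n rewrite ℕ→ℚ≡mkℚ m | ℕ→ℚ≡mkℚ n =
  ℚ.*≤* (subst₂ ℤ._≤_ (sym (ℤP.*-identityʳ (+ m))) (sym (ℤP.*-identityʳ (+ n))) (ℤ.+≤+ m≤n))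

ℕ→ℚ-mono-< : ∀ {m n} → m ℕ.< n → ℕ→ℚ m ℚ.< ℕ→ℚ n
ℕ→ℚ-mono-< {m} {n} m<n rewrite ℕ→ℚ≡mkℚ m | ℕ→ℚ≡mkℚ n =
  ℚ.*<* (subst₂ ℤ._<_ (sym (ℤP.*-identityʳ (+ m))) (sym (ℤP.*-identityʳ (+ n))) (ℤ.+<+ m<n))

floor-between : ∀ m p → ℕ→ℚ m ℚ.≤ p → p ℚ.< ℕ→ℚ (suc m) → floor p ≡ + m
floor-between m p m≤p p<m+1 =
  go p (subst (ℚ._≤ p) (ℕ→ℚ≡mkℚ m) m≤p) (subst (p ℚ.<_) (ℕ→ℚ≡mkℚ (suc m)) p<m+1)
  where
  go : ∀ p → mkℚ (+ m) 0 (coprime-1 m) ℚ.≤ p → p ℚ.< mkℚ (+ suc m) 0 (coprime-1 (suc m)) → floor p ≡ + m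
  go (mkℚ (+ N) d _) (ℚ.*≤* lower) (ℚ.*<* upper) =
    trans (ℤP.*-identityˡ (+ (N ℕD./ suc d))) (cong +_ (ℕP.≤-antisym N/D≤m m≤N/D))
    where
    m*D≤N : m ℕ.* suc d ℕ.≤ N
    m*D≤N = ℤP.drop‿+≤+ (subst₂ ℤ._≤_ (sym (ℤP.pos-* m (suc d))) (ℤP.*-identityʳ (+ N)) lower)
    N<[m+1]*D : N ℕ.< suc m ℕ.* suc d
    N<[m+1]*D = ℤP.drop‿+<+ (subst₂ ℤ._<_ (ℤP.*-identityʳ (+ N)) (sym (ℤP.pos-* (suc m) (suc d))) upper)
    N/D≤m : N ℕD./ suc d ℕ.≤ m
    N/D≤m = ℕP.<⇒≤pred (ℕD.m<n*o⇒m/o<n N<[m+1]*D)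
    m≤N/D : m ℕ.≤ N ℕD./ suc d
    m≤N/D = subst (ℕ._≤ N ℕD./ suc d) (ℕD.m*n/n≡m m (suc d)) (ℕD./-monoˡ-≤ (suc d) m*D≤N)
  go (mkℚ -[1+ N ] d _) (ℚ.*≤* lower) _
    with subst₂ ℤ._≤_ (sym (ℤP.pos-* m (suc d))) (ℤP.*-identityʳ -[1+ N ]) lower
  ... | ()

frac-ℕ+ : ∀ m t → 0ℚ ℚ.≤ t → t ℚ.< 1ℚ → frac (ℕ→ℚ m + t) ≡ t
frac-ℕ+ m t 0≤t t<1 = begin
    (ℕ→ℚ m + t) - ℤ→ℚ (floor (ℕ→ℚ m + t)) ≡⟨ cong (λ z → (ℕ→ℚ m + t) - ℤ→ℚ z) floor≡m ⟩
    (ℕ→ℚ m + t) - ℕ→ℚ m                   ≡⟨ solve 2 (λ a b → (a :+ b) :- a := b) refl (ℕ→ℚ m) t ⟩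
    t                                     ∎
  where
  open ≡-Reasoning
  m≤m+t : ℕ→ℚ m ℚ.≤ ℕ→ℚ m + t
  m≤m+t = subst (ℚ._≤ ℕ→ℚ m + t) (ℚP.+-identityʳ (ℕ→ℚ m)) (ℚP.+-monoʳ-≤ (ℕ→ℚ m) 0≤t)
  m+t<m+1 : ℕ→ℚ m + t ℚ.< ℕ→ℚ (suc m)
  m+t<m+1 = subst (ℕ→ℚ m + t ℚ.<_) (trans (sym (ℕ→ℚ-+ m 1)) (cong ℕ→ℚ (ℕP.+-comm m 1)))
                  (ℚP.+-monoʳ-< (ℕ→ℚ m) t<1)
  floor≡m : floor (ℕ→ℚ m + t) ≡ + m
  floor≡m = floor-between m _ m≤m+t m+t<m+1

frac-ℕ : ∀ m → frac (ℕ→ℚ m) ≡ 0ℚ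
frac-ℕ m = trans (cong frac (sym (ℚP.+-identityʳ (ℕ→ℚ m)))) (frac-ℕ+ m 0ℚ ℚP.≤-refl (ℚP.positive⁻¹ 1ℚ))

fractional-parts-agree : ∀ m n s t → 0ℚ ℚ.≤ s → s ℚ.< 1ℚ → 0ℚ ℚ.≤ t → t ℚ.< 1ℚ →
                         ℕ→ℚ m + s ≡ ℕ→ℚ n + t → s ≡ t
fractional-parts-agree m n s t 0≤s s<1 0≤t t<1 eq =
  trans (sym (frac-ℕ+ m s 0≤s s<1)) (trans (cong frac eq) (frac-ℕ+ n t 0≤t t<1))

positive⇒nonzero : ∀ {p} → 0ℚ ℚ.< p → ¬ p ≡ 0ℚ
positive⇒nonzero 0<p refl = ℚP.<-irrefl refl 0<p

recip-nonzero-def : ∀ x (x≢0 : ¬ x ≡ 0ℚ) → recip x ≡ ℚ.1/_ x {{ℚ.≢-nonZero x≢0}}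
recip-nonzero-def x x≢0 with x ℚP.≟ 0ℚ
... | yes x≡0 = ⊥-elim (x≢0 x≡0)
... | no _ = refl

*-recip : ∀ p → ¬ p ≡ 0ℚ → p * recip p ≡ 1ℚ
*-recip p p≢0 with p ℚP.≟ 0ℚ
... | yes p≡0 = ⊥-elim (p≢0 p≡0)
... | no p≢0′ = ℚP.*-inverseʳ p {{ℚ.≢-nonZero p≢0′}}

invertible⇒nonzero : ∀ p q → p * q ≡ 1ℚ → ¬ p ≡ 0ℚ
invertible⇒nonzero p q pq≡1 p≡0 with trans (sym pq≡1) (trans (cong (_* q) p≡0) (ℚP.*-zeroˡ q))
... | ()

recip-unique : ∀ p q → p * q ≡ 1ℚ → recip p ≡ q
recip-unique p q pq≡1 = begin
    recip p             ≡⟨ sym (ℚP.*-identityʳ (recip p)) ⟩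
    recip p * 1ℚ        ≡⟨ cong (recip p *_) (sym pq≡1) ⟩
    recip p * (p * q)   ≡⟨ sym (ℚP.*-assoc (recip p) p q) ⟩
    (recip p * p) * q   ≡⟨ cong (_* q) (trans (ℚP.*-comm (recip p) p) (*-recip p (invertible⇒nonzero p q pq≡1))) ⟩
    1ℚ * q              ≡⟨ ℚP.*-identityˡ q ⟩
    q                   ∎
  where open ≡-Reasoning

recip-*-self : ∀ p → ¬ p ≡ 0ℚ → recip p * p ≡ 1ℚ
recip-*-self p p≢0 = trans (ℚP.*-comm (recip p) p) (*-recip p p≢0)

recip-involutive : ∀ p → ¬ p ≡ 0ℚ → recip (recip p) ≡ p
recip-involutive p p≢0 = recip-unique (recip p) p (recip-*-self p p≢0)

recip-nonzero : ∀ p → ¬ p ≡ 0ℚ → ¬ recip p ≡ 0ℚ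
recip-nonzero p p≢0 = invertible⇒nonzero (recip p) p (recip-*-self p p≢0)

recip-* : ∀ p q → ¬ p ≡ 0ℚ → ¬ q ≡ 0ℚ → recip (p * q) ≡ recip p * recip q
recip-* p q p≢0 q≢0 = recip-unique (p * q) (recip p * recip q) (begin
    (p * q) * (recip p * recip q)  ≡⟨ solve 4 (λ a b c d → (a :* b) :* (c :* d) := (a :* c) :* (b :* d))
                                              refl p q (recip p) (recip q) ⟩
    (p * recip p) * (q * recip q)  ≡⟨ cong₂ _*_ (*-recip p p≢0) (*-recip q q≢0) ⟩
    1ℚ                             ∎)
  where open ≡-Reasoning

recip-positive : ∀ p → 0ℚ ℚ.< p → 0ℚ ℚ.< recip p
recip-positive p 0<p = subst (0ℚ ℚ.<_) (sym (recip-nonzero-def p (positive⇒nonzero 0<p)))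
  (ℚP.positive⁻¹ _ {{ℚP.1/pos⇒pos p {{ℚ.positive 0<p}}}})

recip<1 : ∀ p → 1ℚ ℚ.< p → recip p ℚ.< 1ℚ
recip<1 p 1<p = ℚP.*-cancelʳ-<-nonNeg p {{ℚ.nonNegative (ℚP.<⇒≤ 0<p)}}
  (subst₂ ℚ._<_ (sym (recip-*-self p (positive⇒nonzero 0<p))) (sym (ℚP.*-identityˡ p)) 1<p)
  where
  0<p : 0ℚ ℚ.< p
  0<p = ℚP.<-trans (ℚP.positive⁻¹ 1ℚ) 1<p

G-nonzero : ∀ x → ¬ x ≡ 0ℚ → G x ≡ frac (recip x)
G-nonzero x x≢0 with x ℚP.≟ 0ℚ
... | yes x≡0 = ⊥-elim (x≢0 x≡0)
... | no x≢0′ = cong frac (recip-nonzero-def x x≢0′)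

-- G(1/x) = frac x: the Gauss map shifts a continued fraction by one digit.
G-recip : ∀ x → ¬ x ≡ 0ℚ → G (recip x) ≡ frac x
G-recip x x≢0 = trans (G-nonzero (recip x) (recip-nonzero x x≢0)) (cong frac (recip-involutive x x≢0))

G-above-1 : ∀ y → 1ℚ ℚ.< y → G y ≡ recip y
G-above-1 y 1<y = trans (G-nonzero y (positive⇒nonzero 0<y))
  (trans (cong frac (sym (ℚP.+-identityˡ (recip y))))
         (frac-ℕ+ 0 (recip y) (ℚP.<⇒≤ (recip-positive y 0<y)) (recip<1 y 1<y)))
  where
  0<y : 0ℚ ℚ.< y
  0<y = ℚP.<-trans (ℚP.positive⁻¹ 1ℚ) 1<y

-- Canonical continued fractions and their tails

tailDigits : ∀ {m} → (Fin (suc (suc m)) → ℕ) → Fin (suc m) → ℕ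
tailDigits a i = a (Fin.suc i)

canonical-tail : ∀ m a → CanonicalDigits (suc m) a → CanonicalDigits m (tailDigits a)
canonical-tail m a (positive , last≥2) = (λ i → positive (Fin.suc i)) , (λ _ → last≥2 (s≤s z≤n))

cf>1 : ∀ m c → (∀ i → 1 ℕ.≤ c i) → 2 ℕ.≤ c (fromℕ m) → 1ℚ ℚ.< cf m c
cf>1 zero c _ last≥2 = ℕ→ℚ-mono-< last≥2
cf>1 (suc m) c positive last≥2 =
  subst (ℚ._< cf (suc m) c) (ℚP.+-identityʳ 1ℚ)
    (ℚP.+-mono-≤-< (ℕ→ℚ-mono-≤ (positive Fin.zero))
      (recip-positive _ (ℚP.<-trans (ℚP.positive⁻¹ 1ℚ) rest>1)))
  where
  rest>1 : 1ℚ ℚ.< cf m (λ i → c (Fin.suc i))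
  rest>1 = cf>1 m (λ i → c (Fin.suc i)) (λ i → positive (Fin.suc i)) last≥2

tail-value>1 : ∀ m a → CanonicalDigits (suc m) a → 1ℚ ℚ.< cf m (tailDigits a)
tail-value>1 m a (positive , last≥2) = cf>1 m (tailDigits a) (λ i → positive (Fin.suc i)) (last≥2 (s≤s z≤n))

tail-value≢0 : ∀ m a → CanonicalDigits (suc m) a → ¬ cf m (tailDigits a) ≡ 0ℚ
tail-value≢0 m a ca = positive⇒nonzero (ℚP.<-trans (ℚP.positive⁻¹ 1ℚ) (tail-value>1 m a ca))

tails-head : ∀ m a → CanonicalDigits (suc m) a → tails (cf (suc m) a) 0 ≡ recip (cf m (tailDigits a))
tails-head m a ca = frac-ℕ+ (a Fin.zero) _
  (ℚP.<⇒≤ (recip-positive _ (ℚP.<-trans (ℚP.positive⁻¹ 1ℚ) (tail-value>1 m a ca))))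
  (recip<1 _ (tail-value>1 m a ca))

tails-shift : ∀ m a → CanonicalDigits (suc m) a → ∀ j → tails (cf (suc m) a) (suc j) ≡ tails (cf m (tailDigits a)) j
tails-shift m a ca zero = trans (cong G (tails-head m a ca)) (G-recip _ (tail-value≢0 m a ca))
tails-shift m a ca (suc j) = cong G (tails-shift m a ca j)

tails-last : ∀ n a → CanonicalDigits n a → tails (cf n a) n ≡ 0ℚ
tails-last zero a _ = frac-ℕ (a Fin.zero)
tails-last (suc m) a ca = trans (tails-shift m a ca m) (tails-last m (tailDigits a) (canonical-tail m a ca))

frac-cf<1 : ∀ n a → CanonicalDigits n a → frac (cf n a) ℚ.< 1ℚ
frac-cf<1 zero a _ = subst (ℚ._< 1ℚ) (sym (frac-ℕ (a Fin.zero))) (ℚP.positive⁻¹ 1ℚ)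
frac-cf<1 (suc m) a ca = subst (ℚ._< 1ℚ) (sym (tails-head m a ca)) (recip<1 _ (tail-value>1 m a ca))

-- Parity bookkeeping: orientation e flipped j times

alt : Bool → ℕ → Bool
alt e zero = e
alt e (suc j) = alt (not e) j

alt-suc : ∀ e j → alt e (suc j) ≡ not (alt e j)
alt-suc e zero = refl
alt-suc e (suc j) = alt-suc (not e) j

alt-parity : ∀ m → (Even m × alt true m ≡ true) ⊎ (¬ Even m × alt true m ≡ false)
alt-parity zero = inj₁ (refl , refl)
alt-parity (suc zero) = inj₂ ((λ ()) , refl)
alt-parity (suc (suc m)) = alt-parity m

by-parity : ∀ m (R : Bool → Set) → R (alt true m) ⇔ ((Even m → R true) × (¬ Even m → R false))
by-parity m R with alt-parity m
... | inj₁ (even , eq) rewrite eq =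
  mk⇔ (λ r → (λ _ → r) , (λ odd → ⊥-elim (odd even))) (λ split → proj₁ split even)
... | inj₂ (odd , eq) rewrite eq =
  mk⇔ (λ r → (λ even → ⊥-elim (odd even)) , (λ _ → r)) (λ split → proj₂ split odd)

-- Oriented ratio k between two continued fractions (any k > 0)

module Ratio (k : ℕ) (0<k : 0 ℕ.< k) where

  K : ℚ
  K = ℕ→ℚ k

  K≢0 : ¬ K ≡ 0ℚ
  K≢0 = positive⇒nonzero (ℕ→ℚ-mono-< 0<k)

  K*K⁻¹* : ∀ u → K * (recip K * u) ≡ u
  K*K⁻¹* u = trans (sym (ℚP.*-assoc K (recip K) u)) (trans (cong (_* u) (*-recip K K≢0)) (ℚP.*-identityˡ u))

  K⁻¹*K* : ∀ u → recip K * (K * u) ≡ u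
  K⁻¹*K* u = trans (sym (ℚP.*-assoc (recip K) K u)) (trans (cong (_* u) (recip-*-self K K≢0)) (ℚP.*-identityˡ u))

  -- u, v in ratio K: u = K v for orientation true (even), v = K u for false (odd).
  Scaled : Bool → ℚ → ℚ → Set
  Scaled true u v = u ≡ K * v
  Scaled false u v = v ≡ K * u

  ScaledN : Bool → ℕ → ℕ → Set
  ScaledN true u v = u ≡ k ℕ.* v
  ScaledN false u v = v ≡ k ℕ.* u

  ScaledN⇒Scaled : ∀ e {u v} → ScaledN e u v → Scaled e (ℕ→ℚ u) (ℕ→ℚ v)
  ScaledN⇒Scaled true {v = v} eq = trans (cong ℕ→ℚ eq) (ℕ→ℚ-* k v)
  ScaledN⇒Scaled false {u = u} eq = trans (cong ℕ→ℚ eq) (ℕ→ℚ-* k u)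

  Scaled⇒ScaledN : ∀ e {u v} → Scaled e (ℕ→ℚ u) (ℕ→ℚ v) → ScaledN e u v
  Scaled⇒ScaledN true {v = v} eq = ℕ→ℚ-injective (trans eq (sym (ℕ→ℚ-* k v)))
  Scaled⇒ScaledN false {u = u} eq = ℕ→ℚ-injective (trans eq (sym (ℕ→ℚ-* k u)))

  scaled-zero : ∀ e → Scaled e 0ℚ 0ℚ
  scaled-zero true = sym (ℚP.*-zeroʳ K)
  scaled-zero false = sym (ℚP.*-zeroʳ K)

  scaled-+ : ∀ e {A B g g'} → Scaled e A B → Scaled e g g' → Scaled e (A + g) (B + g')
  scaled-+ true {B = B} {g' = g'} A≡KB g≡Kg' = trans (cong₂ _+_ A≡KB g≡Kg') (sym (ℚP.*-distribˡ-+ K B g'))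
  scaled-+ false {A = A} {g = g} B≡KA g'≡Kg = trans (cong₂ _+_ B≡KA g'≡Kg) (sym (ℚP.*-distribˡ-+ K A g))

  ratio-cancel : ∀ {A B g g'} → A + g ≡ K * (B + g') → g ≡ K * g' → A ≡ K * B
  ratio-cancel {A} {B} {g} {g'} sum scaled = begin
      A                     ≡⟨ solve 2 (λ a b → a := (a :+ b) :- b) refl A g ⟩
      (A + g) - g           ≡⟨ cong₂ _-_ sum scaled ⟩
      K * (B + g') - K * g' ≡⟨ solve 3 (λ x y z → x :* (y :+ z) :- x :* z := x :* y) refl K B g' ⟩
      K * B                 ∎
    where open ≡-Reasoning

  scaled-cancel : ∀ e {A B g g'} → Scaled e (A + g) (B + g') → Scaled e g g' → Scaled e A B
  scaled-cancel true = ratio-cancel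
  scaled-cancel false = ratio-cancel

  -- Reciprocals invert the ratio, hence swap the orientation.
  ratio-recip : ∀ {u v} → ¬ v ≡ 0ℚ → u ≡ K * v → recip v ≡ K * recip u
  ratio-recip {u} {v} v≢0 u≡Kv = sym (begin
      K * recip u              ≡⟨ cong (λ z → K * recip z) u≡Kv ⟩
      K * recip (K * v)        ≡⟨ cong (K *_) (recip-* K v K≢0 v≢0) ⟩
      K * (recip K * recip v)  ≡⟨ K*K⁻¹* (recip v) ⟩
      recip v                  ∎)
    where open ≡-Reasoning

  scaled-recip : ∀ e {u v} → ¬ u ≡ 0ℚ → ¬ v ≡ 0ℚ → Scaled (not e) u v → Scaled e (recip u) (recip v)
  scaled-recip true u≢0 _ = ratio-recip u≢0
  scaled-recip false _ v≢0 = ratio-recip v≢0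

  scaled-recip⁻¹ : ∀ e {u v} → ¬ u ≡ 0ℚ → ¬ v ≡ 0ℚ → Scaled e (recip u) (recip v) → Scaled (not e) u v
  scaled-recip⁻¹ e {u} {v} u≢0 v≢0 s =
    subst₂ (Scaled (not e)) (recip-involutive u u≢0) (recip-involutive v v≢0)
      (scaled-recip (not e) (recip-nonzero u u≢0) (recip-nonzero v v≢0)
        (subst (λ f → Scaled f (recip u) (recip v)) (sym (not-involutive e)) s))

  -- Digitwise perfectness with orientation e at position 0 (the paper's (1) for e = true).
  PerfectDigits : ∀ n → Bool → (a b : Fin (suc n) → ℕ) → Set
  PerfectDigits n e a b = ∀ (j : Fin (suc n)) → ScaledN (alt e (toℕ j)) (a j) (b j)

  TailCond : (Bool → ℚ → ℚ → Set) → ℕ → Bool → ℚ → ℚ → Set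
  TailCond P n e r r' = ∀ j → suc j ℕ.≤ n → P (alt e j) (tails r j) (tails r' j)

  Gauss : Bool → ℚ → ℚ → Set
  Gauss true g g' = (recip K * G g' ≡ G (K * g')) × (G (recip K * g) ≡ K * G g)
  Gauss false g g' = (recip K * G g ≡ G (K * g)) × (G (recip K * g') ≡ K * G g')

  -- (1) ⇒ γ₀, γ'₀ are in ratio K (as reciprocals of the flipped x, x').
  heads-scaled : ∀ m e a b → CanonicalDigits (suc m) a → CanonicalDigits (suc m) b →
                 PerfectDigits (suc m) e a b → Scaled e (recip (cf m (tailDigits a))) (recip (cf m (tailDigits b)))

  cf-scaled : ∀ n e a b → CanonicalDigits n a → CanonicalDigits n b →
              PerfectDigits n e a b → Scaled e (cf n a) (cf n b)
  cf-scaled zero e a b _ _ perfect = ScaledN⇒Scaled e (perfect Fin.zero)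
  cf-scaled (suc m) e a b ca cb perfect =
    scaled-+ e (ScaledN⇒Scaled e (perfect Fin.zero)) (heads-scaled m e a b ca cb perfect)

  heads-scaled m e a b ca cb perfect =
    scaled-recip e (tail-value≢0 m a ca) (tail-value≢0 m b cb)
      (cf-scaled m (not e) (tailDigits a) (tailDigits b) (canonical-tail m a ca) (canonical-tail m b cb)
        (λ i → perfect (Fin.suc i)))

  tails-scaled : ∀ n e a b → CanonicalDigits n a → CanonicalDigits n b →
                 PerfectDigits n e a b → TailCond Scaled n e (cf n a) (cf n b)
  tails-scaled (suc m) e a b ca cb perfect zero _ =
    subst₂ (Scaled e) (sym (tails-head m a ca)) (sym (tails-head m b cb)) (heads-scaled m e a b ca cb perfect)
  tails-scaled (suc m) e a b ca cb perfect (suc j) (s≤s j<m) =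
    subst₂ (Scaled (alt (not e) j)) (sym (tails-shift m a ca j)) (sym (tails-shift m b cb j))
      (tails-scaled m (not e) (tailDigits a) (tailDigits b) (canonical-tail m a ca) (canonical-tail m b cb)
        (λ i → perfect (Fin.suc i)) j j<m)

  Recovers : (Bool → ℚ → ℚ → Set) → Set
  Recovers P = ∀ e A B x x' → 1ℚ ℚ.< x → 1ℚ ℚ.< x' → frac x ℚ.< 1ℚ → frac x' ℚ.< 1ℚ →
               Scaled e (ℕ→ℚ A + recip x) (ℕ→ℚ B + recip x') → P e (recip x) (recip x') →
               Scaled e (recip x) (recip x')

  -- Permutiple + a recovering tail condition ⇒ (1): peel off a₀, b₀ and recurse on x, x'.
  perfect-from-tails : ∀ P → Recovers P → ∀ n e a b → CanonicalDigits n a → CanonicalDigits n b →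
                       Scaled e (cf n a) (cf n b) → TailCond P n e (cf n a) (cf n b) → PerfectDigits n e a b
  perfect-from-tails _ _ zero e a b _ _ scaled _ Fin.zero = Scaled⇒ScaledN e scaled
  perfect-from-tails P recovers (suc m) e a b ca cb scaled tailCond = λ
    { Fin.zero → Scaled⇒ScaledN e (scaled-cancel e scaled heads)
    ; (Fin.suc i) → perfect-from-tails P recovers m (not e) (tailDigits a) (tailDigits b)
        (canonical-tail m a ca) (canonical-tail m b cb)
        (scaled-recip⁻¹ e (tail-value≢0 m a ca) (tail-value≢0 m b cb) heads) shifted i
    }
    where
    heads : Scaled e (recip (cf m (tailDigits a))) (recip (cf m (tailDigits b)))
    heads = recovers e (a Fin.zero) (b Fin.zero) _ _ (tail-value>1 m a ca) (tail-value>1 m b cb)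
      (frac-cf<1 m (tailDigits a) (canonical-tail m a ca)) (frac-cf<1 m (tailDigits b) (canonical-tail m b cb))
      scaled (subst₂ (P e) (tails-head m a ca) (tails-head m b cb) (tailCond 0 (s≤s z≤n)))
    shifted : TailCond P m (not e) (cf m (tailDigits a)) (cf m (tailDigits b))
    shifted j j<m = subst₂ (P (alt (not e) j)) (tails-shift m a ca j) (tails-shift m b cb j) (tailCond (suc j) (s≤s j<m))

  scaled-recovers : Recovers Scaled
  scaled-recovers _ _ _ _ _ _ _ _ _ _ scaled = scaled

  -- If K/x' > 1 the first Gauss identity would say frac x' = x', impossible for x' > 1.
  gauss-forbids-large : ∀ x' → 1ℚ ℚ.< x' → frac x' ℚ.< 1ℚ → 1ℚ ℚ.< K * recip x' →
                        ¬ (recip K * G (recip x') ≡ G (K * recip x'))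
  gauss-forbids-large x' 1<x' frac<1 1<y gauss = ℚP.<-irrefl refl (ℚP.<-trans 1<x' (subst (ℚ._< 1ℚ) frac≡x' frac<1))
    where
    open ≡-Reasoning
    x'≢0 : ¬ x' ≡ 0ℚ
    x'≢0 = positive⇒nonzero (ℚP.<-trans (ℚP.positive⁻¹ 1ℚ) 1<x')
    frac≡x' : frac x' ≡ x'
    frac≡x' = begin
      frac x'                          ≡⟨ sym (K*K⁻¹* (frac x')) ⟩
      K * (recip K * frac x')          ≡⟨ cong (λ z → K * (recip K * z)) (sym (G-recip x' x'≢0)) ⟩
      K * (recip K * G (recip x'))     ≡⟨ cong (K *_) gauss ⟩
      K * G (K * recip x')             ≡⟨ cong (K *_) (G-above-1 _ 1<y) ⟩
      K * recip (K * recip x')         ≡⟨ cong (K *_) (recip-* K (recip x') K≢0 (recip-nonzero x' x'≢0)) ⟩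
      K * (recip K * recip (recip x')) ≡⟨ K*K⁻¹* _ ⟩
      recip (recip x')                 ≡⟨ recip-involutive x' x'≢0 ⟩
      x'                               ∎

  -- (3) recovers γ₀ = K γ'₀ from a₀ + γ₀ = K b₀ + K γ'₀, by comparing K γ'₀ with 1.
  gauss-recovers-even : ∀ A B x x' → 1ℚ ℚ.< x → 1ℚ ℚ.< x' → frac x' ℚ.< 1ℚ →
                        ℕ→ℚ A + recip x ≡ K * (ℕ→ℚ B + recip x') →
                        recip K * G (recip x') ≡ G (K * recip x') → recip x ≡ K * recip x'
  gauss-recovers-even A B x x' 1<x 1<x' frac<1 scaled gauss = compare-with-1
    where
    0<γ : 0ℚ ℚ.< recip x
    0<γ = recip-positive x (ℚP.<-trans (ℚP.positive⁻¹ 1ℚ) 1<x)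
    0≤γ : 0ℚ ℚ.≤ recip x
    0≤γ = ℚP.<⇒≤ 0<γ
    γ<1 : recip x ℚ.< 1ℚ
    γ<1 = recip<1 x 1<x
    0<y : 0ℚ ℚ.< K * recip x'
    0<y = ℚP.positive⁻¹ _ {{ℚP.pos*pos⇒pos K {{ℚ.positive (ℕ→ℚ-mono-< 0<k)}} (recip x')
            {{ℚ.positive (recip-positive x' (ℚP.<-trans (ℚP.positive⁻¹ 1ℚ) 1<x'))}}}}
    sum : ℕ→ℚ A + recip x ≡ ℕ→ℚ (k ℕ.* B) + K * recip x'
    sum = trans scaled (trans (ℚP.*-distribˡ-+ K (ℕ→ℚ B) (recip x')) (cong (_+ K * recip x') (sym (ℕ→ℚ-* k B))))
    compare-with-1 : recip x ≡ K * recip x'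
    compare-with-1 with ℚP.<-cmp (K * recip x') 1ℚ
    ... | tri< y<1 _ _ = fractional-parts-agree A (k ℕ.* B) _ _ 0≤γ γ<1 (ℚP.<⇒≤ 0<y) y<1 sum
    ... | tri≈ _ y≡1 _ = ⊥-elim (positive⇒nonzero 0<γ (fractional-parts-agree A (k ℕ.* B ℕ.+ 1) _ _
          0≤γ γ<1 ℚP.≤-refl (ℚP.positive⁻¹ 1ℚ)
          (trans sum (trans (cong (λ y → ℕ→ℚ (k ℕ.* B) + y) y≡1)
                            (trans (sym (ℕ→ℚ-+ (k ℕ.* B) 1)) (sym (ℚP.+-identityʳ _)))))))
    ... | tri> _ _ 1<y = ⊥-elim (gauss-forbids-large x' 1<x' frac<1 1<y gauss)

  -- The odd orientation is the even case with the roles of r and r' swapped.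
  gauss-recovers : Recovers Gauss
  gauss-recovers true A B x x' 1<x 1<x' _ frac'<1 scaled gauss =
    gauss-recovers-even A B x x' 1<x 1<x' frac'<1 scaled (proj₁ gauss)
  gauss-recovers false A B x x' 1<x 1<x' frac<1 _ scaled gauss =
    gauss-recovers-even B A x' x 1<x' 1<x frac<1 scaled (proj₁ gauss)

  gauss-from-scaled : ∀ e g g' → Scaled e g g' → Scaled (not e) (G g) (G g') → Gauss e g g'
  gauss-from-scaled true g g' g≡Kg' Gg'≡KGg = first , second
    where
    open ≡-Reasoning
    first : recip K * G g' ≡ G (K * g')
    first = begin
      recip K * G g'        ≡⟨ cong (recip K *_) Gg'≡KGg ⟩
      recip K * (K * G g)   ≡⟨ K⁻¹*K* (G g) ⟩
      G g                   ≡⟨ cong G g≡Kg' ⟩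
      G (K * g')            ∎
    second : G (recip K * g) ≡ K * G g
    second = begin
      G (recip K * g)        ≡⟨ cong (λ z → G (recip K * z)) g≡Kg' ⟩
      G (recip K * (K * g')) ≡⟨ cong G (K⁻¹*K* g') ⟩
      G g'                   ≡⟨ Gg'≡KGg ⟩
      K * G g                ∎
  gauss-from-scaled false g g' = gauss-from-scaled true g' g

  -- (1) ⇒ (3), using (2) at j and at j + 1 (or γₙ = γ'ₙ = 0 when j + 1 = n).
  gauss-tails : ∀ n e a b → CanonicalDigits n a → CanonicalDigits n b →
                PerfectDigits n e a b → TailCond Gauss n e (cf n a) (cf n b)
  gauss-tails n e a b ca cb perfect j j<n = gauss-from-scaled (alt e j) _ _ (ratios j j<n) next
    where
    ratios = tails-scaled n e a b ca cb perfect
    next : Scaled (not (alt e j)) (tails (cf n a) (suc j)) (tails (cf n b) (suc j))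
    next with suc (suc j) ℕ.≤? n
    ... | yes j+1<n = subst (λ f → Scaled f _ _) (alt-suc e j) (ratios (suc j) j+1<n)
    ... | no j+1≮n = subst₂ (Scaled (not (alt e j))) (sym (last a ca)) (sym (last b cb)) (scaled-zero _)
      where
      last : ∀ c → CanonicalDigits n c → tails (cf n c) (suc j) ≡ 0ℚ
      last c cc = trans (cong (tails (cf n c)) (ℕP.≤-antisym j<n (ℕP.≮⇒≥ j+1≮n))) (tails-last n c cc)

  perfect⇔scaled-tails : ∀ n e a b → CanonicalDigits n a → CanonicalDigits n b → Scaled e (cf n a) (cf n b) →
                         PerfectDigits n e a b ⇔ TailCond Scaled n e (cf n a) (cf n b)
  perfect⇔scaled-tails n e a b ca cb scaled =
    mk⇔ (tails-scaled n e a b ca cb) (perfect-from-tails Scaled scaled-recovers n e a b ca cb scaled)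

  perfect⇔gauss-tails : ∀ n e a b → CanonicalDigits n a → CanonicalDigits n b → Scaled e (cf n a) (cf n b) →
                        PerfectDigits n e a b ⇔ TailCond Gauss n e (cf n a) (cf n b)
  perfect⇔gauss-tails n e a b ca cb scaled =
    mk⇔ (gauss-tails n e a b ca cb) (perfect-from-tails Gauss gauss-recovers n e a b ca cb scaled)

  perfect⇔PerfectDigits : ∀ n σ a → Perfect n k σ a ⇔ PerfectDigits n true a (permuted σ a)
  perfect⇔PerfectDigits n σ a = mk⇔
    (λ perfect j → Equivalence.from (by-parity (toℕ j) (λ f → ScaledN f (a j) (permuted σ a j))) (perfect j))
    (λ perfect j → Equivalence.to (by-parity (toℕ j) (λ f → ScaledN f (a j) (permuted σ a j))) (perfect j))

  tailCond⇔parity : ∀ P n r r' → TailCond P n true r r' ⇔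
                    (∀ j → suc j ℕ.≤ n → (Even j → P true (tails r j) (tails r' j)) × (¬ Even j → P false (tails r j) (tails r' j)))
  tailCond⇔parity P n r r' = mk⇔
    (λ cond j j<n → Equivalence.to (by-parity j (λ f → P f (tails r j) (tails r' j))) (cond j j<n))
    (λ cond j j<n → Equivalence.from (by-parity j (λ f → P f (tails r j) (tails r' j))) (cond j j<n))

theorem10 : (n k : ℕ) → 1 < k → (σ : Permutation′ (suc n)) → (a : Fin (suc n) → ℕ) →
    CanonicalDigits n a → CanonicalDigits n (permuted σ a) →
    IsPermutiple n k σ a →
    (Perfect n k σ a ⇔ Cond2 n k (tails (cf n a)) (tails (cf n (permuted σ a)))) ×
    (Perfect n k σ a ⇔ Cond3 n k (tails (cf n a)) (tails (cf n (permuted σ a))))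
theorem10 n k 1<k σ a ca cb permutiple =
    ⇔.trans (perfect⇔PerfectDigits n σ a)
      (⇔.trans (perfect⇔scaled-tails n true a b ca cb permutiple) (tailCond⇔parity Scaled n _ _)) ,
    ⇔.trans (perfect⇔PerfectDigits n σ a)
      (⇔.trans (perfect⇔gauss-tails n true a b ca cb permutiple) (tailCond⇔parity Gauss n _ _))
  where
  open Ratio k (ℕP.<-trans z<s 1<k)
  b = permuted σ a
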